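{- Fix $M\in\{1,2,\dots\}\cup\{\infty\}$ and let $G=\langle X\mid\mathcal R\rangle$ be a group presentation with $X$ finite such that $\exp_X(r)\equiv0\pmod M$ for every relator $r\in\mathcal R$. Let $H$ be a subgroup of $G$ and $\vec\Gamma=\vec{\mathrm{Sch}}(G,H,X)$. Then every connected component of $\vec\Gamma\otimes\vec C_M$ (with the label of an edge $(e,f)$ taken to be the label of $e$) is strongly isomorphic (as a labeled oriented graph) to the Schreier graph $\vec{\mathrm{Sch}}(G,H_M,X)$, where $H_M=\{h\in H:\exp_X(h)\equiv0\pmod M\}$.
   Context: For a word $w$ over $X\sqcup X^{ -1}$, $\exp_X(w)$ is the number of letters from $X$ minus the number of letters from $X^{ -1}$; under the hypothesis, $\exp_X$ is well defined on $G$ modulo $M$ (congruence modulo $\infty$ means equality). For $H\le G$, the oriented Schreier graph $\vec{\mathrm{Sch}}(G,H,X)$ has vertex set the right cosets $Hg$ and an edge labeled $x$ from $Hg$ to $Hgx$ for each $x\in X$. The tensor product $\vec\Gamma\otimes\vec\Delta$ of oriented graphs has vertex set $V(\vec\Gamma)\times V(\vec\Delta)$ and an edge $(e,f)$ from $(v_1,w_1)$ to $(v_2,w_2)$ for each edge $e\colon v_1\to v_2$ and $f\colon w_1\to w_2$. $\vec C_M$ has vertex set $\mathbb Z/M\mathbb Z$ ($\mathbb Z$ if $M=\infty$) and one edge $i\to i+1$ for each $i$. Connected components are taken in the non-oriented sense. -}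

module Defs where

open import Data.Nat using (ℕ; NonZero)
open import Data.Fin using (Fin)
open import Data.Integer using (ℤ; +_; -[1+_]; _+_; _-_; _*_)
open import Data.List using (List; []; _∷_; _++_; reverse; map)
open import Data.Product using (Σ; _×_; _,_; ∃; proj₁; proj₂)
open import Data.Unit using (⊤; tt)
open import Relation.Binary.PropositionalEquality using (_≡_)

data Letter (X : Set) : Set where
  pos : X → Letter X
  neg : X → Letter X

Word : Set → Set
Word X = List (Letter X)

invL : {X : Set} → Letter X → Letter X
invL (pos x) = neg x
invL (neg x) = pos x

invW : {X : Set} → Word X → Word X
invW w = reverse (map invL w)

expL : {X : Set} → Letter X → ℤ
expL (pos _) = + 1
expL (neg _) = -[1+ 0 ]

expW : {X : Set} → Word X → ℤ
expW []      = + 0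
expW (a ∷ w) = expL a + expW w

data Modulus : Set where
  finite   : (m : ℕ) → NonZero m → Modulus
  infinite : Modulus

_≡_[mod_] : ℤ → ℤ → Modulus → Set
a ≡ b [mod finite m _ ] = ∃ λ (k : ℤ) → a - b ≡ k * + m
a ≡ b [mod infinite ]   = a ≡ b

-- The group G = ⟨X ∣ 𝓡⟩: words modulo the congruence generated by
-- free cancellation and the relators (𝓡 is a predicate on words).

data Rel⟨_⟩ {X : Set} (R : Word X → Set) : Word X → Word X → Set where
  ≈refl    : ∀ {w} → Rel⟨ R ⟩ w w
  ≈sym     : ∀ {u v} → Rel⟨ R ⟩ u v → Rel⟨ R ⟩ v u
  ≈trans   : ∀ {u v w} → Rel⟨ R ⟩ u v → Rel⟨ R ⟩ v w → Rel⟨ R ⟩ u w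
  ≈cong    : ∀ {u u′ v v′} → Rel⟨ R ⟩ u u′ → Rel⟨ R ⟩ v v′ → Rel⟨ R ⟩ (u ++ v) (u′ ++ v′)
  ≈cancel  : (a : Letter X) → Rel⟨ R ⟩ (a ∷ invL a ∷ []) []
  ≈relator : ∀ {r} → R r → Rel⟨ R ⟩ r []

record Subgroup {X : Set} (R : Word X → Set) : Set₁ where
  field
    mem     : Word X → Set
    mem-resp : ∀ {u v} → Rel⟨ R ⟩ u v → mem u → mem v
    mem-ε   : mem []
    mem-·   : ∀ {u v} → mem u → mem v → mem (u ++ v)
    mem-inv : ∀ {u} → mem u → mem (invW u)

record LGraph (L : Set) : Set₁ where
  field
    V     : Set
    _≈V_  : V → V → Set
    E     : Set
    _≈E_  : E → E → Set
    src   : E → V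
    tgt   : E → V
    label : E → L

open LGraph public

record _≅_ {L : Set} (Γ Δ : LGraph L) : Set where
  field
    fV      : V Γ → V Δ
    gV      : V Δ → V Γ
    fV-cong : ∀ {v w} → _≈V_ Γ v w → _≈V_ Δ (fV v) (fV w)
    gV-cong : ∀ {v w} → _≈V_ Δ v w → _≈V_ Γ (gV v) (gV w)
    gfV     : ∀ v → _≈V_ Γ (gV (fV v)) v
    fgV     : ∀ v → _≈V_ Δ (fV (gV v)) v
    fE      : E Γ → E Δ
    gE      : E Δ → E Γ
    fE-cong : ∀ {e f} → _≈E_ Γ e f → _≈E_ Δ (fE e) (fE f)
    gE-cong : ∀ {e f} → _≈E_ Δ e f → _≈E_ Γ (gE e) (gE f)
    gfE     : ∀ e → _≈E_ Γ (gE (fE e)) e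
    fgE     : ∀ e → _≈E_ Δ (fE (gE e)) e
    src-pres   : ∀ e → _≈V_ Δ (src Δ (fE e)) (fV (src Γ e))
    tgt-pres   : ∀ e → _≈V_ Δ (tgt Δ (fE e)) (fV (tgt Γ e))
    label-pres : ∀ e → label Δ (fE e) ≡ label Γ e

_⊗_ : {L₁ L₂ : Set} → LGraph L₁ → LGraph L₂ → LGraph L₁
Γ ⊗ Δ = record
  { V     = V Γ × V Δ
  ; _≈V_  = λ p q → _≈V_ Γ (proj₁ p) (proj₁ q) × _≈V_ Δ (proj₂ p) (proj₂ q)
  ; E     = E Γ × E Δ
  ; _≈E_  = λ p q → _≈E_ Γ (proj₁ p) (proj₁ q) × _≈E_ Δ (proj₂ p) (proj₂ q)
  ; src   = λ p → src Γ (proj₁ p) , src Δ (proj₂ p)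
  ; tgt   = λ p → tgt Γ (proj₁ p) , tgt Δ (proj₂ p)
  ; label = λ p → label Γ (proj₁ p)
  }

data Conn {L : Set} (Γ : LGraph L) (u : V Γ) : V Γ → Set where
  here : Conn Γ u u
  resp : ∀ {v w} → Conn Γ u v → _≈V_ Γ v w → Conn Γ u w
  fwd  : ∀ e → Conn Γ u (src Γ e) → Conn Γ u (tgt Γ e)
  bwd  : ∀ e → Conn Γ u (tgt Γ e) → Conn Γ u (src Γ e)

Component : {L : Set} (Γ : LGraph L) → V Γ → LGraph L
Component Γ v₀ = record
  { V     = Σ (V Γ) (Conn Γ v₀)
  ; _≈V_  = λ p q → _≈V_ Γ (proj₁ p) (proj₁ q)
  ; E     = Σ (E Γ) (λ e → Conn Γ v₀ (src Γ e))
  ; _≈E_  = λ p q → _≈E_ Γ (proj₁ p) (proj₁ q)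
  ; src   = λ p → src Γ (proj₁ p) , proj₂ p
  ; tgt   = λ p → tgt Γ (proj₁ p) , fwd (proj₁ p) (proj₂ p)
  ; label = λ p → label Γ (proj₁ p)
  }

-- Oriented Schreier graph Sch(G, H, X) for the subgroup with membership
-- predicate P: vertices are right cosets Hg (words g, with Hg = Hg′ iff
-- g g′⁻¹ ∈ H), one edge labeled x from Hg to Hgx for each x ∈ X.

Sch : {X : Set} → (Word X → Set) → LGraph X
Sch {X} P = record
  { V     = Word X
  ; _≈V_  = λ g g′ → P (g ++ invW g′)
  ; E     = Word X × X
  ; _≈E_  = λ p q → P (proj₁ p ++ invW (proj₁ q)) × proj₂ p ≡ proj₂ q
  ; src   = proj₁
  ; tgt   = λ p → proj₁ p ++ (pos (proj₂ p) ∷ [])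
  ; label = proj₂
  }

-- the oriented cycle C_M (the bi-infinite line if M = ∞)
Cyc : Modulus → LGraph ⊤
Cyc M = record
  { V     = ℤ
  ; _≈V_  = λ i j → i ≡ j [mod M ]
  ; E     = ℤ
  ; _≈E_  = λ i j → i ≡ j [mod M ]
  ; src   = λ i → i
  ; tgt   = λ i → i + + 1
  ; label = λ _ → tt
  }

restrictM : {X : Set} → Modulus → (Word X → Set) → (Word X → Set)
restrictM M P h = P h × (expW h ≡ + 0 [mod M ])

-- Fix the base vertex (g₀ , i₀). Walking along an edge labelled by a letter l
-- changes the first coordinate by l and the second by exp(l), so along any
-- path from the base the second coordinate stays congruent mod M to the
-- level  i₀ + exp(g₀⁻¹ w)  of the word w read off from the path. Hence the
-- component is the graph of the level function: w ↦ (Hw , level w) is onto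
-- it, and two words give the same vertex exactly when they differ by an
-- element of H whose exponent sum vanishes mod M, i.e. by an element of H_M.
module Submission where

open import Defs
open import Data.Nat using (ℕ)
open import Data.Fin using (Fin)
open import Data.Integer using (ℤ; +_; -[1+_]; _+_; _-_; -_; _*_)
open import Data.Integer.Properties
  using (+-identityˡ; +-identityʳ; +-assoc; +-comm; +-inverseˡ; *-distribʳ-+; neg-distrib-+;
         neg-distribˡ-*; i≡j⇒i-j≡0; i-j≡0⇒i≡j)
open import Data.Integer.Tactic.RingSolver using (solve-∀)
open import Data.List using ([]; _∷_; _++_; [_]; _∷ʳ_; reverse; map)
open import Data.List.Properties using (++-assoc; ++-identityʳ; map-++; reverse-++)
open import Data.Product using (_×_; _,_)
open import Relation.Binary.Bundles using (Setoid)
open import Relation.Binary.PropositionalEquality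
  using (_≡_; refl; sym; trans; cong; cong₂; subst; module ≡-Reasoning)
import Relation.Binary.Reasoning.Setoid as SetoidReasoning

module _ where
  open ≡-Reasoning

  ≡mod-refl : ∀ M {a} → a ≡ a [mod M ]
  ≡mod-refl (finite m _) {a} = + 0 , i≡j⇒i-j≡0 {a} refl
  ≡mod-refl infinite     = refl

  ≡mod-reflexive : ∀ M {a b} → a ≡ b → a ≡ b [mod M ]
  ≡mod-reflexive M refl = ≡mod-refl M

  ≡mod-sym : ∀ M {a b} → a ≡ b [mod M ] → b ≡ a [mod M ]
  ≡mod-sym (finite m _) {a} {b} (k , a-b≡km) = - k , (begin
    b - a          ≡⟨ b-a≡-[a-b] a b ⟩
    - (a - b)      ≡⟨ cong -_ a-b≡km ⟩
    - (k * + m)    ≡⟨ neg-distribˡ-* k (+ m) ⟩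
    - k * + m      ∎)
    where
    b-a≡-[a-b] : ∀ a b → b - a ≡ - (a - b)
    b-a≡-[a-b] = solve-∀
  ≡mod-sym infinite = sym

  ≡mod-trans : ∀ M {a b c} → a ≡ b [mod M ] → b ≡ c [mod M ] → a ≡ c [mod M ]
  ≡mod-trans (finite m _) {a} {b} {c} (k , a-b≡km) (l , b-c≡lm) = k + l , (begin
    a - c                  ≡⟨ telescope a b c ⟩
    (a - b) + (b - c)      ≡⟨ cong₂ _+_ a-b≡km b-c≡lm ⟩
    k * + m + l * + m      ≡⟨ sym (*-distribʳ-+ (+ m) k l) ⟩
    (k + l) * + m          ∎)
    where
    telescope : ∀ a b c → a - c ≡ (a - b) + (b - c)
    telescope = solve-∀
  ≡mod-trans infinite = trans

  +-congʳ-≡mod : ∀ M {a b} (c : ℤ) → a ≡ b [mod M ] → (a + c) ≡ (b + c) [mod M ]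
  +-congʳ-≡mod (finite m _) {a} {b} c (k , a-b≡km) = k , trans (shift a b c) a-b≡km
    where
    shift : ∀ a b c → (a + c) - (b + c) ≡ a - b
    shift = solve-∀
  +-congʳ-≡mod infinite c = cong (_+ c)

  ≡mod⇒-≡mod0 : ∀ M {a b} → a ≡ b [mod M ] → (a - b) ≡ + 0 [mod M ]
  ≡mod⇒-≡mod0 (finite m _) {a} {b} (k , a-b≡km) = k , trans (+-identityʳ (a - b)) a-b≡km
  ≡mod⇒-≡mod0 infinite = i≡j⇒i-j≡0

  -≡mod0⇒≡mod : ∀ M {a b} → (a - b) ≡ + 0 [mod M ] → a ≡ b [mod M ]
  -≡mod0⇒≡mod (finite m _) {a} {b} (k , e) = k , trans (sym (+-identityʳ (a - b))) e
  -≡mod0⇒≡mod infinite {a} {b} = i-j≡0⇒i≡j a b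

module _ {X : Set} where
  open ≡-Reasoning


  expW-++ : ∀ (u v : Word X) → expW (u ++ v) ≡ expW u + expW v
  expW-++ []      v = sym (+-identityˡ (expW v))
  expW-++ (a ∷ u) v = trans (cong (λ z → expL a + z) (expW-++ u v)) (sym (+-assoc (expL a) (expW u) (expW v)))

  expW-∷ʳ : ∀ (w : Word X) l → expW (w ∷ʳ l) ≡ expW w + expL l
  expW-∷ʳ w l = trans (expW-++ w [ l ]) (cong (λ z → expW w + z) (+-identityʳ (expL l)))

  invL-involutive : ∀ (l : Letter X) → invL (invL l) ≡ l
  invL-involutive (pos x) = refl
  invL-involutive (neg x) = refl

  expL-invL : ∀ (l : Letter X) → expL (invL l) ≡ - expL l
  expL-invL (pos x) = refl
  expL-invL (neg x) = refl

  +-expL-invL : ∀ j (l : Letter X) → (j + expL l) + expL (invL l) ≡ j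
  +-expL-invL j (pos x) = cancel j
    where
    cancel : ∀ j → (j + + 1) + -[1+ 0 ] ≡ j
    cancel = solve-∀
  +-expL-invL j (neg x) = cancel j
    where
    cancel : ∀ j → (j + -[1+ 0 ]) + + 1 ≡ j
    cancel = solve-∀

  invW-++ : ∀ (u v : Word X) → invW (u ++ v) ≡ invW v ++ invW u
  invW-++ u v = trans (cong reverse (map-++ invL u v)) (reverse-++ (map invL u) (map invL v))

  invW-involutive : ∀ (w : Word X) → invW (invW w) ≡ w
  invW-involutive []      = refl
  invW-involutive (a ∷ w) = begin
    invW (invW ([ a ] ++ w))          ≡⟨ cong invW (invW-++ [ a ] w) ⟩
    invW (invW w ++ [ invL a ])       ≡⟨ invW-++ (invW w) [ invL a ] ⟩
    invL (invL a) ∷ invW (invW w)     ≡⟨ cong₂ _∷_ (invL-involutive a) (invW-involutive w) ⟩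
    a ∷ w                             ∎

  expW-invW : ∀ (w : Word X) → expW (invW w) ≡ - expW w
  expW-invW []      = refl
  expW-invW (a ∷ w) = begin
    expW (invW ([ a ] ++ w))          ≡⟨ cong expW (invW-++ [ a ] w) ⟩
    expW (invW w ∷ʳ invL a)           ≡⟨ expW-∷ʳ (invW w) (invL a) ⟩
    expW (invW w) + expL (invL a)     ≡⟨ cong₂ _+_ (expW-invW w) (expL-invL a) ⟩
    - expW w + - expL a               ≡⟨ +-comm (- expW w) (- expL a) ⟩
    - expL a + - expW w               ≡⟨ sym (neg-distrib-+ (expL a) (expW w)) ⟩
    - (expL a + expW w)               ∎

  expW-++-invW : ∀ (u v : Word X) → expW (u ++ invW v) ≡ expW u - expW v
  expW-++-invW u v = trans (expW-++ u (invW v)) (cong (λ z → expW u + z) (expW-invW v))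

module Presentation {X : Set} (R : Word X → Set) where

  wordSetoid : Setoid _ _
  wordSetoid = record
    { Carrier       = Word X
    ; _≈_           = Rel⟨ R ⟩
    ; isEquivalence = record { refl = ≈refl ; sym = ≈sym ; trans = ≈trans }
    }

  open SetoidReasoning wordSetoid

  ≈-reflexive : ∀ {u v} → u ≡ v → Rel⟨ R ⟩ u v
  ≈-reflexive refl = ≈refl

  ++-invW-≈ε : ∀ (w : Word X) → Rel⟨ R ⟩ (w ++ invW w) []
  ++-invW-≈ε []      = ≈refl
  ++-invW-≈ε (a ∷ w) = begin
    a ∷ w ++ invW ([ a ] ++ w)          ≡⟨ cong (λ u → a ∷ w ++ u) (invW-++ [ a ] w) ⟩
    a ∷ w ++ (invW w ∷ʳ invL a)         ≡⟨ cong (a ∷_) (sym (++-assoc w (invW w) [ invL a ])) ⟩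
    [ a ] ++ (w ++ invW w) ++ [ invL a ] ≈⟨ ≈cong (≈refl {w = [ a ]}) (≈cong (++-invW-≈ε w) ≈refl) ⟩
    a ∷ invL a ∷ []                     ≈⟨ ≈cancel a ⟩
    []                                  ∎

  invW-++-≈ε : ∀ (w : Word X) → Rel⟨ R ⟩ (invW w ++ w) []
  invW-++-≈ε w = subst (λ u → Rel⟨ R ⟩ (invW w ++ u) []) (invW-involutive w) (++-invW-≈ε (invW w))

  ++-invW-++-≈ : ∀ (u w : Word X) → Rel⟨ R ⟩ (u ++ (invW u ++ w)) w
  ++-invW-++-≈ u w = begin
    u ++ (invW u ++ w)                  ≡⟨ sym (++-assoc u (invW u) w) ⟩
    (u ++ invW u) ++ w                  ≈⟨ ≈cong (++-invW-≈ε u) ≈refl ⟩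
    w                                   ∎

  ∷ʳ-invL-≈ : ∀ (w : Word X) l → Rel⟨ R ⟩ ((w ∷ʳ l) ∷ʳ invL l) w
  ∷ʳ-invL-≈ w l = begin
    (w ∷ʳ l) ∷ʳ invL l                  ≡⟨ ++-assoc w [ l ] [ invL l ] ⟩
    w ++ (l ∷ invL l ∷ [])              ≈⟨ ≈cong (≈refl {w = w}) (≈cancel l) ⟩
    w ++ []                             ≡⟨ ++-identityʳ w ⟩
    w                                   ∎

  module Cosets (H : Subgroup R) where
    open Subgroup H

    -- Hu = Hv. A record rather than a synonym, so that u and v can be
    -- recovered from a proof by unification.
    record _∼_ (u v : Word X) : Set where
      constructor coset
      field coset-mem : mem (u ++ invW v)

    open _∼_ public

    ≈⇒∼ : ∀ {u v} → Rel⟨ R ⟩ u v → u ∼ v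
    ≈⇒∼ {u} {v} u≈v = coset (mem-resp (begin
      []                  ≈⟨ ≈sym (++-invW-≈ε v) ⟩
      v ++ invW v         ≈⟨ ≈cong (≈sym u≈v) ≈refl ⟩
      u ++ invW v         ∎) mem-ε)

    ∼-sym : ∀ {u v} → u ∼ v → v ∼ u
    ∼-sym {u} {v} (coset h) = coset (subst mem inverse (mem-inv h))
      where
      inverse : invW (u ++ invW v) ≡ v ++ invW u
      inverse = trans (invW-++ u (invW v)) (cong (_++ invW u) (invW-involutive v))

    ∼-trans : ∀ {u v w} → u ∼ v → v ∼ w → u ∼ w
    ∼-trans {u} {v} {w} (coset h) (coset h′) = coset (mem-resp (begin
      (u ++ invW v) ++ (v ++ invW w)  ≡⟨ ++-assoc u (invW v) (v ++ invW w) ⟩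
      u ++ (invW v ++ (v ++ invW w))  ≡⟨ cong (u ++_) (sym (++-assoc (invW v) v (invW w))) ⟩
      u ++ ((invW v ++ v) ++ invW w)  ≈⟨ ≈cong (≈refl {w = u}) (≈cong (invW-++-≈ε v) ≈refl) ⟩
      u ++ invW w                     ∎) (mem-· h h′))

    ∼-++ʳ : ∀ {u v} w → u ∼ v → (u ++ w) ∼ (v ++ w)
    ∼-++ʳ {u} {v} w (coset h) = coset (mem-resp (begin
      u ++ invW v                       ≈⟨ ≈cong (≈refl {w = u}) (≈sym (++-invW-++-≈ w (invW v))) ⟩
      u ++ (w ++ (invW w ++ invW v))    ≡⟨ sym (++-assoc u w _) ⟩
      (u ++ w) ++ (invW w ++ invW v)    ≡⟨ cong ((u ++ w) ++_) (sym (invW-++ v w)) ⟩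
      (u ++ w) ++ invW (v ++ w)         ∎) h)

module SchreierTensorCycle (M : Modulus) {X : Set} {R : Word X → Set} (H : Subgroup R)
                           (g₀ : Word X) (i₀ : ℤ) where
  open Subgroup H
  open Presentation R
  open Cosets H

  Γ : LGraph X
  Γ = Sch mem ⊗ Cyc M

  Reach : V Γ → Set
  Reach = Conn Γ (g₀ , i₀)

  -- the second coordinate reached from (g₀ , i₀) by following the word g₀⁻¹ w
  level : Word X → ℤ
  level w = i₀ + expW (invW g₀ ++ w)

  level-g₀ : level g₀ ≡ i₀
  level-g₀ = begin
    i₀ + expW (invW g₀ ++ g₀)             ≡⟨ cong (λ z → i₀ + z) (expW-++ (invW g₀) g₀) ⟩
    i₀ + (expW (invW g₀) + expW g₀)       ≡⟨ cong (λ z → i₀ + (z + expW g₀)) (expW-invW g₀) ⟩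
    i₀ + (- expW g₀ + expW g₀)            ≡⟨ cong (λ z → i₀ + z) (+-inverseˡ (expW g₀)) ⟩
    i₀ + + 0                              ≡⟨ +-identityʳ i₀ ⟩
    i₀                                    ∎
    where open ≡-Reasoning

  level-∷ʳ : ∀ w l → level (w ∷ʳ l) ≡ level w + expL l
  level-∷ʳ w l = begin
    i₀ + expW (invW g₀ ++ (w ∷ʳ l))       ≡⟨ cong (λ u → i₀ + expW u) (sym (++-assoc (invW g₀) w [ l ])) ⟩
    i₀ + expW ((invW g₀ ++ w) ∷ʳ l)       ≡⟨ cong (λ z → i₀ + z) (expW-∷ʳ (invW g₀ ++ w) l) ⟩
    i₀ + (expW (invW g₀ ++ w) + expL l)   ≡⟨ sym (+-assoc i₀ _ (expL l)) ⟩
    level w + expL l                      ∎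
    where open ≡-Reasoning

  level-diff : ∀ u v → level u - level v ≡ expW (u ++ invW v)
  level-diff u v = begin
    level u - level v                     ≡⟨ cong₂ (λ a b → (i₀ + a) - (i₀ + b)) (expW-++ (invW g₀) u) (expW-++ (invW g₀) v) ⟩
    (i₀ + (e + expW u)) - (i₀ + (e + expW v)) ≡⟨ cancel i₀ e (expW u) (expW v) ⟩
    expW u - expW v                       ≡⟨ sym (expW-++-invW u v) ⟩
    expW (u ++ invW v)                    ∎
    where
    open ≡-Reasoning
    e = expW (invW g₀)
    cancel : ∀ i e a b → (i + (e + a)) - (i + (e + b)) ≡ a - b
    cancel = solve-∀

  step : ∀ {u j} → Reach (u , j) → ∀ l → Reach (u ∷ʳ l , j + expL l)
  step {u} {j} p (pos x) = fwd ((u , x) , j) p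
  step {u} {j} p (neg x) = bwd ((u ∷ʳ neg x , x) , j + expL (neg x))
    (resp p (coset-mem (∼-sym (≈⇒∼ (∷ʳ-invL-≈ u (neg x))))
            , ≡mod-reflexive M (sym (+-expL-invL j (neg x)))))

  walk : ∀ {u j} → Reach (u , j) → ∀ w → Reach (u ++ w , j + expW w)
  walk {u} {j} p []      = subst Reach (cong₂ _,_ (sym (++-identityʳ u)) (sym (+-identityʳ j))) p
  walk {u} {j} p (l ∷ w) = subst Reach (cong₂ _,_ (++-assoc u [ l ] w) (+-assoc j (expL l) (expW w)))
                                 (walk (step p l) w)

  reach : ∀ w → Reach (w , level w)
  reach w = resp (walk here (invW g₀ ++ w)) (coset-mem (≈⇒∼ (++-invW-++-≈ g₀ w)) , ≡mod-refl M)

  trace : ∀ {v} → Reach v → Word X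
  trace here                    = g₀
  trace (resp p _)              = trace p
  trace (fwd ((_ , x) , _) p)   = trace p ∷ʳ pos x
  trace (bwd ((_ , x) , _) p)   = trace p ∷ʳ neg x

  Levelled : Word X → V Γ → Set
  Levelled w (g , i) = w ∼ g × level w ≡ i [mod M ]

  Levelled-∷ʳ : ∀ {w g i} l → Levelled w (g , i) → Levelled (w ∷ʳ l) (g ∷ʳ l , i + expL l)
  Levelled-∷ʳ {w} l (w∼g , w≡i) =
    ∼-++ʳ [ l ] w∼g , ≡mod-trans M (≡mod-reflexive M (level-∷ʳ w l)) (+-congʳ-≡mod M (expL l) w≡i)

  Levelled-resp : ∀ {w v v′} → Levelled w v → _≈V_ Γ v v′ → Levelled w v′
  Levelled-resp (w∼g , w≡i) (h , i≡i′) = ∼-trans w∼g (coset h) , ≡mod-trans M w≡i i≡i′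

  Levelled-unique : ∀ {u w v} → Levelled u v → Levelled w v → Levelled u (w , level w)
  Levelled-unique (u∼g , u≡i) (w∼g , w≡i) = ∼-trans u∼g (∼-sym w∼g) , ≡mod-trans M u≡i (≡mod-sym M w≡i)

  trace-Levelled : ∀ {v} (p : Reach v) → Levelled (trace p) v
  trace-Levelled here                  = ≈⇒∼ ≈refl , ≡mod-reflexive M level-g₀
  trace-Levelled (resp p v≈v′)         = Levelled-resp (trace-Levelled p) v≈v′
  trace-Levelled (fwd ((_ , x) , _) p) = Levelled-∷ʳ (pos x) (trace-Levelled p)
  trace-Levelled (bwd ((g , x) , j) p) = Levelled-resp (Levelled-∷ʳ (neg x) (trace-Levelled p))
    (coset-mem (≈⇒∼ (∷ʳ-invL-≈ g (pos x))) , ≡mod-reflexive M (+-expL-invL j (pos x)))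

  Levelled⇒restrictM : ∀ {u v} → Levelled u (v , level v) → restrictM M mem (u ++ invW v)
  Levelled⇒restrictM {u} {v} (u∼v , u≡v) =
    coset-mem u∼v , subst (λ z → z ≡ + 0 [mod M ]) (level-diff u v) (≡mod⇒-≡mod0 M u≡v)

  restrictM⇒Levelled : ∀ {u v} → restrictM M mem (u ++ invW v) → Levelled u (v , level v)
  restrictM⇒Levelled {u} {v} (h , exp≡0) =
    coset h , -≡mod0⇒≡mod M (subst (λ z → z ≡ + 0 [mod M ]) (sym (level-diff u v)) exp≡0)

  trace-cong : ∀ {v v′} (p : Reach v) (q : Reach v′) → _≈V_ Γ v v′ →
               restrictM M mem (trace p ++ invW (trace q))
  trace-cong p q v≈v′ =
    Levelled⇒restrictM (Levelled-unique (Levelled-resp (trace-Levelled p) v≈v′) (trace-Levelled q))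

  trace-reach : ∀ w → restrictM M mem (trace (reach w) ++ invW w)
  trace-reach w = Levelled⇒restrictM (trace-Levelled (reach w))

  restrictM-refl : ∀ w → restrictM M mem (w ++ invW w)
  restrictM-refl w = Levelled⇒restrictM {w} (≈⇒∼ ≈refl , ≡mod-refl M)

  component≅Sch : Component Γ (g₀ , i₀) ≅ Sch (restrictM M mem)
  component≅Sch = record
    { fV         = λ (_ , p) → trace p
    ; gV         = λ w → (w , level w) , reach w
    ; fV-cong    = λ { {_ , p} {_ , q} → trace-cong p q }
    ; gV-cong    = λ r → to-≈V (restrictM⇒Levelled r)
    ; gfV        = λ (_ , p) → to-≈V (trace-Levelled p)
    ; fgV        = trace-reach
    ; fE         = λ (((_ , x) , _) , p) → trace p , x
    ; gE         = λ (w , x) → ((w , x) , level w) , reach w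
    ; fE-cong    = λ { {(_ , p)} {(_ , q)} ((h , x≡x′) , i≡i′) → trace-cong p q (h , i≡i′) , x≡x′ }
    ; gE-cong    = λ (r , x≡x′) → edge (restrictM⇒Levelled r) x≡x′
    ; gfE        = λ (_ , p) → edge (trace-Levelled p) refl
    ; fgE        = λ (w , _) → trace-reach w , refl
    ; src-pres   = λ (_ , p) → restrictM-refl (trace p)
    ; tgt-pres   = λ (((_ , x) , _) , p) → restrictM-refl (trace p ∷ʳ pos x)
    ; label-pres = λ _ → refl
    }
    where
    to-≈V : ∀ {w v} → Levelled w v → _≈V_ Γ (w , level w) v
    to-≈V (w∼g , w≡i) = coset-mem w∼g , w≡i
    edge : ∀ {w g i x x′} → Levelled w (g , i) → x ≡ x′ →
           _≈E_ Γ ((w , x) , level w) ((g , x′) , i)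
    edge (w∼g , w≡i) x≡x′ = (coset-mem w∼g , x≡x′) , w≡i

proposition3p17 : (M : Modulus) (n : ℕ) (R : Word (Fin n) → Set)
    → (∀ r → R r → expW r ≡ + 0 [mod M ])
    → (H : Subgroup R)
    → (v₀ : V (Sch (Subgroup.mem H) ⊗ Cyc M))
    → Component (Sch (Subgroup.mem H) ⊗ Cyc M) v₀ ≅ Sch (restrictM M (Subgroup.mem H))
proposition3p17 M n R _ H (g₀ , i₀) = SchreierTensorCycle.component≅Sch M H g₀ i₀
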